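{- Let $C$ and $C'$ be columns of the same height $k$ with entries in $[\overline{n}]$, and let $D'=\mathrm{ord}(C')$, $D=\mathrm{ord}(C)$. Assume the pair $C'C$ satisfies Conditions C and R1. (1) If $C'C$ also satisfies Condition R2, then for every $a$, $a\in\mathrm{int}(C,C')$ if and only if $\overline{a}\in\mathrm{int}(C,C')$. (2) The pair $C'C$ satisfies Conditions R2 and R3 if and only if the pair $D'D$ satisfies Conditions R2 and R3.
   Context: $[\overline{n}]=\{1<\dots<n<\overline{n}<\dots<\overline{1}\}$, $\overline{\overline{a}}=a$, $|\overline{\imath}|=i$. A column of height $k$ is a sequence $(C(1),\dots,C(k))$ of elements of $[\overline{n}]$ with distinct absolute values; $\mathrm{ord}$ sorts it increasingly. Condition C on $C'C$: for all $1\le i<l\le k$, both $C(i)=C'(l)$ and $C(i)\prec C'(l)\prec C'(i)$ fail, $\prec$ the circular order on $[\overline{n}]$ (cyclic sequence $1,\dots,n,\overline{n},\dots,\overline{1}$) starting at $C(i)$. Condition R1: $\{|C(i)|\}_{i}=\{|C'(i)|\}_{i}$. Condition R2: for each $i$, $C(i)\le C'(i)\le n$ or $\overline{n}\le C(i)\le C'(i)$. Condition R3: $\mathrm{int}(C,C')=\emptyset$, where $\mathrm{int}(C,C')=\bigl(\bigcup_{i=1}^k\{j\in[\overline{n}]:C(i)<j<C'(i)\}\bigr)\setminus\{C(i),\overline{C(i)}:1\le i\le k\}$. -}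

module Defs where

open import Data.Nat using (ℕ; zero; suc; _+_; _*_; _∸_; _<_; _≤_; _≤ᵇ_)
open import Data.Fin using (Fin; toℕ) renaming (_<_ to _<ᶠ_)
open import Data.Vec using (Vec; []; _∷_; lookup)
open import Data.Bool using (if_then_else_)
open import Data.Product using (_×_; ∃-syntax)
open import Data.Sum using (_⊎_)
open import Relation.Nullary using (¬_)
open import Relation.Binary.PropositionalEquality using (_≡_; _≢_)

-- The alphabet [n̄] = {1 < ... < n < n̄ < ... < 1̄}.
-- pos i stands for the letter i+1, neg i for the barred letter (i+1)‾ (i : Fin n, 0-based).
data Letter (n : ℕ) : Set where
  pos : Fin n → Letter n
  neg : Fin n → Letter n

bar : ∀ {n} → Letter n → Letter n
bar (pos i) = neg i
bar (neg i) = pos i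

∣_∣ᴸ : ∀ {n} → Letter n → Fin n
∣ pos i ∣ᴸ = i
∣ neg i ∣ᴸ = i

rank : ∀ {n} → Letter n → ℕ
rank {n} (pos i) = toℕ i
rank {n} (neg i) = (n + n) ∸ suc (toℕ i)

_<ᴸ_ : ∀ {n} → Letter n → Letter n → Set
x <ᴸ y = rank x < rank y

_≤ᴸ_ : ∀ {n} → Letter n → Letter n → Set
x ≤ᴸ y = rank x ≤ rank y

-- "x ≤ n" : x is unbarred ; "n̄ ≤ x" : x is barred
_≤n : ∀ {n} → Letter n → Set
_≤n {n} x = rank x < n

n̄≤_ : ∀ {n} → Letter n → Set
n̄≤_ {n} x = n ≤ rank x

-- Circular order on [n̄] (cyclic sequence 1,...,n,n̄,...,1̄) starting at c:
-- distance of x from c going around the cycle.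
cyc : ∀ {n} → Letter n → Letter n → ℕ
cyc {n} c x = if rank c ≤ᵇ rank x then rank x ∸ rank c else (n + n + rank x) ∸ rank c

_≺_≺_ : ∀ {n} → Letter n → Letter n → Letter n → Set
c ≺ x ≺ y = (cyc c c < cyc c x) × (cyc c x < cyc c y)

IsColumn : ∀ {n k} → Vec (Letter n) k → Set
IsColumn {n} {k} C = ∀ (i j : Fin k) → ∣ lookup C i ∣ᴸ ≡ ∣ lookup C j ∣ᴸ → i ≡ j

insert : ∀ {n k} → Letter n → Vec (Letter n) k → Vec (Letter n) (suc k)
insert x [] = x ∷ []
insert x (y ∷ ys) = if rank x ≤ᵇ rank y then x ∷ y ∷ ys else y ∷ insert x ys

ord : ∀ {n k} → Vec (Letter n) k → Vec (Letter n) k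
ord [] = []
ord (x ∷ xs) = insert x (ord xs)

-- Conditions on the pair C'C (first argument C', second argument C).
CondC : ∀ {n k} → Vec (Letter n) k → Vec (Letter n) k → Set
CondC {n} {k} C' C = ∀ (i l : Fin k) → i <ᶠ l →
  (lookup C i ≢ lookup C' l) × ¬ (lookup C i ≺ lookup C' l ≺ lookup C' i)

CondR1 : ∀ {n k} → Vec (Letter n) k → Vec (Letter n) k → Set
CondR1 {n} {k} C' C =
  (∀ (i : Fin k) → ∃[ j ] ∣ lookup C i ∣ᴸ ≡ ∣ lookup C' j ∣ᴸ) ×
  (∀ (j : Fin k) → ∃[ i ] ∣ lookup C' j ∣ᴸ ≡ ∣ lookup C i ∣ᴸ)

CondR2 : ∀ {n k} → Vec (Letter n) k → Vec (Letter n) k → Set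
CondR2 {n} {k} C' C = ∀ (i : Fin k) →
  ((lookup C i ≤ᴸ lookup C' i) × (lookup C' i) ≤n) ⊎
  ((n̄≤ lookup C i) × (lookup C i ≤ᴸ lookup C' i))

InInt : ∀ {n k} → Vec (Letter n) k → Vec (Letter n) k → Letter n → Set
InInt {n} {k} C C' j =
  (∃[ i ] ((lookup C i <ᴸ j) × (j <ᴸ lookup C' i))) ×
  (∀ (i : Fin k) → (j ≢ lookup C i) × (j ≢ bar (lookup C i)))

CondR3 : ∀ {n k} → Vec (Letter n) k → Vec (Letter n) k → Set
CondR3 {n} C' C = ∀ (j : Letter n) → ¬ InInt C C' j

-- When C ≤ C' entrywise, a lies in int(C,C') exactly when ∣a∣ is not an absolute
-- value of C and C' has fewer entries below a than C.  If j is not an absolute value, passing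
-- from the letter j to j̄ adds to both counts the number of absolute values exceeding j, which is
-- the same for C and C' by R1 and the distinctness of absolute values in a column; hence (1).
-- For (2), R2 implies a comparison of the counting functions of C' and C that does not see the
-- order of the entries.  Conversely this comparison gives back R2 for sorted columns, and for C'C
-- itself in presence of Condition C, which forces C'(1) to lie between C(1) and every later entry
-- of C' above C(1).  With R2 on both pairs, the counting description of int(C,C') shows that R3
-- is order-invariant as well.

module Submission where

open import Defs
open import Data.Bool using (true; false)
open import Data.Fin using (Fin; toℕ; zero; suc)
open import Data.Fin.Properties using (toℕ-injective; toℕ<n; any?)
import Data.Fin.Properties as Fin
open import Data.List using (List; []; _∷_; map)
open import Data.Nat.ListAction using (sum)
open import Data.List.Membership.Propositional using (_∈_; _─_)
open import Data.List.Relation.Binary.Subset.Propositional using (_⊆_)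
open import Data.List.Relation.Unary.Any using (here; there)
import Data.List.Relation.Unary.All as ListAll
open import Data.List.Relation.Unary.Unique.Propositional using (Unique; []; _∷_)
open import Data.Nat using (ℕ; suc; _+_; _<_; _≤_; z≤n; s≤s; z<s; s<s; _≤ᵇ_)
open import Data.Nat.Properties
open import Algebra.Properties.CommutativeSemigroup +-commutativeSemigroup using (x∙yz≈y∙xz; interchange)
open import Data.Product using (_×_; _,_; proj₁; proj₂; ∃-syntax)
open import Data.Sum using (_⊎_; inj₁; inj₂)
open import Data.Vec using (Vec; []; _∷_; lookup; head; tail)
open import Data.Vec.Relation.Unary.All using (All; []; _∷_)
import Data.Vec.Relation.Unary.All as All
open import Data.Vec.Relation.Unary.All.Properties using (lookup⁺; lookup⁻)
open import Data.Vec.Relation.Unary.AllPairs using (AllPairs; []; _∷_)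
open import Function using (_∘_)
open import Function.Bundles using (_⇔_; mk⇔; Equivalence)
import Function.Properties.Equivalence as ⇔
open import Relation.Binary.PropositionalEquality
open import Relation.Binary.Definitions using (tri<; tri≈; tri>)
open import Relation.Nullary using (Dec; yes; no; ¬_; contradiction)
open import Relation.Nullary.Decidable using (_×-dec_)
open import Relation.Nullary.Reflects using (ofʸ; ofⁿ)

open Equivalence using (to; from)

private
  variable
    n k : ℕ
    x y : Letter n
    xs ys : Vec (Letter n) k

module _ {a} {A : Set a} (f : A → ℕ) where

  sum-map-─ : ∀ {x} {ys : List A} (x∈ys : x ∈ ys) → sum (map f ys) ≡ f x + sum (map f (ys ─ x∈ys))
  sum-map-─ (here refl) = refl
  sum-map-─ {x} {y ∷ ys} (there x∈ys) = begin
    f y + sum (map f ys)                   ≡⟨ cong (f y +_) (sum-map-─ x∈ys) ⟩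
    f y + (f x + sum (map f (ys ─ x∈ys)))  ≡⟨ x∙yz≈y∙xz (f y) (f x) _ ⟩
    f x + (f y + sum (map f (ys ─ x∈ys)))  ∎
    where open ≡-Reasoning

  ∈-─ : ∀ {c x} {ys : List A} (c∈ys : c ∈ ys) (x∈ys : x ∈ ys) → x ≢ c → c ∈ ys ─ x∈ys
  ∈-─ (here refl)  (here refl)  x≢c = contradiction refl x≢c
  ∈-─ (there c∈ys) (here refl)  _   = c∈ys
  ∈-─ (here refl)  (there _)    _   = here refl
  ∈-─ (there c∈ys) (there x∈ys) x≢c = there (∈-─ c∈ys x∈ys x≢c)

  sum-map-mono-⊆ : ∀ {xs ys : List A} → Unique xs → xs ⊆ ys → sum (map f xs) ≤ sum (map f ys)
  sum-map-mono-⊆ {[]} _ _ = z≤n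
  sum-map-mono-⊆ {x ∷ xs} {ys} (x∉xs ∷ unique) xs⊆ys = begin
    f x + sum (map f xs)           ≤⟨ +-monoʳ-≤ (f x) (sum-map-mono-⊆ unique xs⊆ys─x) ⟩
    f x + sum (map f (ys ─ x∈ys))  ≡⟨ sum-map-─ x∈ys ⟨
    sum (map f ys)                 ∎
    where
    open ≤-Reasoning
    x∈ys = xs⊆ys (here refl)
    xs⊆ys─x : xs ⊆ ys ─ x∈ys
    xs⊆ys─x c∈xs = ∈-─ (xs⊆ys (there c∈xs)) x∈ys (ListAll.lookup x∉xs c∈xs)

  sum-map-≡ : ∀ {xs ys : List A} → Unique xs → Unique ys → xs ⊆ ys → ys ⊆ xs →
              sum (map f xs) ≡ sum (map f ys)
  sum-map-≡ uxs uys xs⊆ys ys⊆xs = ≤-antisym (sum-map-mono-⊆ uxs xs⊆ys) (sum-map-mono-⊆ uys ys⊆xs)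

m+o≤n+p⇒o≤p : ∀ {m n o p} → n ≤ m → m + o ≤ n + p → o ≤ p
m+o≤n+p⇒o≤p {m} {n} {o} {p} n≤m le = +-cancelˡ-≤ m o p (≤-trans le (+-monoˡ-≤ p n≤m))

rank<2n : (x : Letter n) → rank x < n + n
rank<2n {n} (pos i) = <-≤-trans (toℕ<n i) (m≤m+n n n)
rank<2n {n} (neg i) = ∸-monoʳ-< z<s (≤-trans (toℕ<n i) (m≤m+n n n))

n≤rank-neg : (i : Fin n) → n ≤ rank (neg i)
n≤rank-neg {n} i = subst (_≤ rank (neg i)) (m+n∸n≡m n n) (∸-monoʳ-≤ (n + n) (toℕ<n i))

rank-injective : rank x ≡ rank y → x ≡ y
rank-injective {x = pos i} {pos j} e = cong pos (toℕ-injective e)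
rank-injective {x = pos i} {neg j} e = contradiction (subst (_ ≤_) (sym e) (n≤rank-neg j)) (<⇒≱ (toℕ<n i))
rank-injective {x = neg i} {pos j} e = contradiction (subst (_ ≤_) e (n≤rank-neg i)) (<⇒≱ (toℕ<n j))
rank-injective {n} {neg i} {neg j} e = cong neg (toℕ-injective (suc-injective
  (∸-cancelˡ-≡ (≤-trans (toℕ<n i) (m≤m+n n n)) (≤-trans (toℕ<n j) (m≤m+n n n)) e)))

rank-neg-<⇔ : {i j : Fin n} → rank (neg i) < rank (neg j) ⇔ toℕ j < toℕ i
rank-neg-<⇔ {n} {i} {j} = mk⇔
  (λ lt → ≰⇒> λ i≤j → <⇒≱ lt (∸-monoʳ-≤ (n + n) (s≤s i≤j)))
  (λ j<i → ∸-monoʳ-< (s<s j<i) (≤-trans (toℕ<n i) (m≤m+n n n)))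

∣bar∣ : (x : Letter n) → ∣ bar x ∣ᴸ ≡ ∣ x ∣ᴸ
∣bar∣ (pos i) = refl
∣bar∣ (neg i) = refl

≢±⇔∣∣≢ : {a x : Letter n} → ((a ≢ x) × (a ≢ bar x)) ⇔ (∣ x ∣ᴸ ≢ ∣ a ∣ᴸ)
≢±⇔∣∣≢ {x = x} = mk⇔ (λ (a≢x , a≢x̄) → ∣∣≢ a≢x a≢x̄)
  (λ ∣x∣≢∣a∣ → (λ a≡x → ∣x∣≢∣a∣ (cong ∣_∣ᴸ (sym a≡x)))
             , (λ a≡x̄ → ∣x∣≢∣a∣ (trans (sym (∣bar∣ x)) (cong ∣_∣ᴸ (sym a≡x̄)))))
  where
  ∣∣≢ : ∀ {a x : Letter n} → a ≢ x → a ≢ bar x → ∣ x ∣ᴸ ≢ ∣ a ∣ᴸ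
  ∣∣≢ {a = pos i} {pos .i} a≢x _   refl = a≢x refl
  ∣∣≢ {a = pos i} {neg .i} _   a≢x̄ refl = a≢x̄ refl
  ∣∣≢ {a = neg i} {pos .i} _   a≢x̄ refl = a≢x̄ refl
  ∣∣≢ {a = neg i} {neg .i} a≢x _   refl = a≢x refl

cyc+rank : (c x : Letter n) → rank c ≤ rank x → cyc c x + rank c ≡ rank x
cyc+rank c x c≤x with rank c ≤ᵇ rank x | ≤ᵇ-reflects-≤ (rank c) (rank x)
... | true  | _       = m∸n+n≡m c≤x
... | false | ofⁿ c≰x = contradiction c≤x c≰x

cyc+rank-wrap : (c x : Letter n) → rank x < rank c → cyc c x + rank c ≡ n + n + rank x
cyc+rank-wrap {n} c x x<c with rank c ≤ᵇ rank x | ≤ᵇ-reflects-≤ (rank c) (rank x)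
... | true  | ofʸ c≤x = contradiction c≤x (<⇒≱ x<c)
... | false | _       = m∸n+n≡m (≤-trans (<⇒≤ (rank<2n c)) (m≤m+n (n + n) (rank x)))

¬≺≺⇒≤≤ : (x y z : Letter n) → rank x < rank z → ¬ (x ≺ z ≺ y) →
         rank x ≤ rank y × rank y ≤ rank z
¬≺≺⇒≤≤ {n} x y z x<z ¬x≺z≺y = x≤y , subst (_≤ rank z) (cyc+rank x y x≤y) bound
  where
  x≺z : cyc x x < cyc x z
  x≺z = +-cancelʳ-< (rank x) (cyc x x) (cyc x z)
          (subst₂ _<_ (sym (cyc+rank x x ≤-refl)) (sym (cyc+rank x z (<⇒≤ x<z))) x<z)
  bound : cyc x y + rank x ≤ rank z
  bound = subst (_ ≤_) (cyc+rank x z (<⇒≤ x<z))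
                (+-monoˡ-≤ (rank x) (≮⇒≥ (λ z≺y → ¬x≺z≺y (x≺z , z≺y))))
  x≤y : rank x ≤ rank y
  x≤y = ≮⇒≥ λ y<x → <⇒≱ (rank<2n z)
          (≤-trans (m≤m+n (n + n) (rank y)) (subst (_≤ rank z) (cyc+rank-wrap x y y<x) bound))

-- Matching on the Dec itself rather than on `does` lets `with r <? t` make 𝟙[ r < t ] compute.
𝟙 : ∀ {ℓ} {A : Set ℓ} → Dec A → ℕ
𝟙 (yes _) = 1
𝟙 (no _)  = 0

𝟙[_<_] : ℕ → ℕ → ℕ
𝟙[ r < t ] = 𝟙 (r <? t)

𝟙-yes : ∀ {r t} → r < t → 𝟙[ r < t ] ≡ 1
𝟙-yes {r} {t} r<t with r <? t
... | yes _   = refl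
... | no r≮t = contradiction r<t r≮t

𝟙-no : ∀ {r t} → t ≤ r → 𝟙[ r < t ] ≡ 0
𝟙-no {r} {t} t≤r with r <? t
... | yes r<t = contradiction r<t (≤⇒≯ t≤r)
... | no _    = refl

𝟙-mono : ∀ {r s r′ t} → (r < s → r′ < t) → 𝟙[ r < s ] ≤ 𝟙[ r′ < t ]
𝟙-mono {r} {s} {r′} {t} h with r <? s | r′ <? t
... | yes _   | yes _    = ≤-refl
... | yes r<s | no r′≮t = contradiction (h r<s) r′≮t
... | no _    | _        = z≤n

𝟙-strict : ∀ {r s r′ t} → s ≤ r → r′ < t → 𝟙[ r < s ] < 𝟙[ r′ < t ]
𝟙-strict s≤r r′<t = subst₂ _<_ (sym (𝟙-no s≤r)) (sym (𝟙-yes r′<t)) z<s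

𝟙-cong : ∀ {r s r′ t} → (r < s ⇔ r′ < t) → 𝟙[ r < s ] ≡ 𝟙[ r′ < t ]
𝟙-cong e = ≤-antisym (𝟙-mono (to e)) (𝟙-mono (from e))

countBelow : ℕ → Vec (Letter n) k → ℕ
countBelow t []       = 0
countBelow t (x ∷ xs) = 𝟙[ rank x < t ] + countBelow t xs

countBelow-mono : ∀ {s t} (A B : Vec (Letter n) k) →
  (∀ i → rank (lookup A i) < s → rank (lookup B i) < t) → countBelow s A ≤ countBelow t B
countBelow-mono []      []      _ = z≤n
countBelow-mono (_ ∷ A) (_ ∷ B) h = +-mono-≤ (𝟙-mono (h zero)) (countBelow-mono A B (h ∘ suc))

countBelow-strict : ∀ {s t} (A B : Vec (Letter n) k) →
  (∀ i → rank (lookup A i) < s → rank (lookup B i) < t) →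
  ∃[ i ] (s ≤ rank (lookup A i) × rank (lookup B i) < t) → countBelow s A < countBelow t B
countBelow-strict (_ ∷ A) (_ ∷ B) h (zero , s≤a , b<t) =
  +-mono-<-≤ (𝟙-strict s≤a b<t) (countBelow-mono A B (h ∘ suc))
countBelow-strict (_ ∷ A) (_ ∷ B) h (suc i , w) =
  +-mono-≤-< (𝟙-mono (h zero)) (countBelow-strict A B (h ∘ suc) (i , w))

countBelow-<⇒∃ : ∀ {s t} (A B : Vec (Letter n) k) → countBelow t B < countBelow s A →
  ∃[ i ] (rank (lookup A i) < s × t ≤ rank (lookup B i))
countBelow-<⇒∃ {s = s} {t} A B lt with any? (λ i → rank (lookup A i) <? s ×-dec t ≤? rank (lookup B i))
... | yes w = w
... | no ∄w = contradiction (countBelow-mono A B λ i a<s → ≰⇒> λ t≤b → ∄w (i , a<s , t≤b))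
                            (<⇒≱ lt)

countBelow-∷-cancel : ∀ {t} (X Y : Vec (Letter n) (suc k)) → head X ≤ᴸ head Y →
  countBelow t X ≤ countBelow t Y → countBelow t (tail X) ≤ countBelow t (tail Y)
countBelow-∷-cancel (_ ∷ _) (_ ∷ _) x≤y = m+o≤n+p⇒o≤p (𝟙-mono (≤-<-trans x≤y))

insert-countBelow : ∀ t (x : Letter n) (v : Vec (Letter n) k) →
                    countBelow t (insert x v) ≡ 𝟙[ rank x < t ] + countBelow t v
insert-countBelow t x []       = refl
insert-countBelow t x (y ∷ ys) with rank x ≤ᵇ rank y
... | true  = refl
... | false = trans (cong (𝟙[ rank y < t ] +_) (insert-countBelow t x ys))
                    (x∙yz≈y∙xz 𝟙[ rank y < t ] 𝟙[ rank x < t ] (countBelow t ys))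

ord-countBelow : ∀ t (v : Vec (Letter n) k) → countBelow t (ord v) ≡ countBelow t v
ord-countBelow t []       = refl
ord-countBelow t (x ∷ xs) = trans (insert-countBelow t x (ord xs)) (cong (_ +_) (ord-countBelow t xs))

module _ {ℓ} {P : Letter n → Set ℓ} where

  All-insert⁺ : P x → All P xs → All P (insert x xs)
  All-insert⁺ {xs = []}     px []          = px ∷ []
  All-insert⁺ {x = x} {xs = y ∷ ys} px (py ∷ pys) with rank x ≤ᵇ rank y
  ... | true  = px ∷ py ∷ pys
  ... | false = py ∷ All-insert⁺ px pys

  All-insert⁻ : All P (insert x xs) → P x × All P xs
  All-insert⁻ {xs = []}     (px ∷ []) = px , []
  All-insert⁻ {x = x} {xs = y ∷ ys} ps with rank x ≤ᵇ rank y | ps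
  ... | true  | px ∷ pys = px , pys
  ... | false | py ∷ ps′ with All-insert⁻ {xs = ys} ps′
  ...   | px , pys = px , py ∷ pys

  All-ord : All P (ord xs) ⇔ All P xs
  All-ord = mk⇔ ord⁻ ord⁺
    where
    ord⁻ : All P (ord xs) → All P xs
    ord⁻ {xs = []}     []  = []
    ord⁻ {xs = x ∷ xs} ps with All-insert⁻ ps
    ... | px , pxs = px ∷ ord⁻ pxs
    ord⁺ : All P xs → All P (ord xs)
    ord⁺ []         = []
    ord⁺ (px ∷ pxs) = All-insert⁺ px (ord⁺ pxs)

Sorted : Vec (Letter n) k → Set
Sorted = AllPairs _≤ᴸ_

insert-sorted : (x : Letter n) → Sorted xs → Sorted (insert x xs)
insert-sorted {xs = []} x [] = [] ∷ []
insert-sorted {xs = y ∷ ys} x (y≤ys ∷ ys↑)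
  with rank x ≤ᵇ rank y | ≤ᵇ-reflects-≤ (rank x) (rank y)
... | true  | ofʸ x≤y = (x≤y ∷ All.map (≤-trans x≤y) y≤ys) ∷ y≤ys ∷ ys↑
... | false | ofⁿ x≰y = All-insert⁺ {xs = ys} (<⇒≤ (≰⇒> x≰y)) y≤ys ∷ insert-sorted x ys↑

ord-sorted : (v : Vec (Letter n) k) → Sorted (ord v)
ord-sorted []       = []
ord-sorted (x ∷ xs) = insert-sorted x (ord-sorted xs)

sorted-head-≤ : Sorted (x ∷ xs) → ∀ i → x ≤ᴸ lookup (x ∷ xs) i
sorted-head-≤ _           zero    = ≤-refl
sorted-head-≤ (x≤xs ∷ _) (suc i) = lookup⁺ x≤xs i

R2Pair : Letter n → Letter n → Set
R2Pair x y = ((x ≤ᴸ y) × (y ≤n)) ⊎ ((n̄≤ x) × (x ≤ᴸ y))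

R2Pair⇒≤ᴸ : R2Pair x y → x ≤ᴸ y
R2Pair⇒≤ᴸ (inj₁ (x≤y , _)) = x≤y
R2Pair⇒≤ᴸ (inj₂ (_ , x≤y)) = x≤y

R2Pair⇒≤n : R2Pair x y → x ≤n → y ≤n
R2Pair⇒≤n (inj₁ (_ , y<n)) _   = y<n
R2Pair⇒≤n (inj₂ (n≤x , _)) x<n = contradiction x<n (≤⇒≯ n≤x)

R2Pair-intro : x ≤ᴸ y → (x ≤n → y ≤n) → R2Pair x y
R2Pair-intro {n} {x} x≤y side with rank x <? n
... | yes x<n = inj₁ (x≤y , side x<n)
... | no x≮n  = inj₂ (≮⇒≥ x≮n , x≤y)

CondR2-∷ : R2Pair x y → CondR2 ys xs → CondR2 (y ∷ ys) (x ∷ xs)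
CondR2-∷ head _    zero    = head
CondR2-∷ _    tail (suc i) = tail i

-- Unlike CondR2, this only depends on the multisets of entries.
CountR2 : Vec (Letter n) k → Vec (Letter n) k → Set
CountR2 {n} C' C = (∀ t → countBelow t C' ≤ countBelow t C) × countBelow n C ≤ countBelow n C'

CondR2⇒≤ᴸ : (C C' : Vec (Letter n) k) → CondR2 C' C → ∀ i → lookup C i ≤ᴸ lookup C' i
CondR2⇒≤ᴸ C C' r2 i = R2Pair⇒≤ᴸ {x = lookup C i} {lookup C' i} (r2 i)

R2⇒CountR2 : (C C' : Vec (Letter n) k) → CondR2 C' C → CountR2 C' C
R2⇒CountR2 C C' r2 =
  (λ t → countBelow-mono C' C λ i y<t → ≤-<-trans (CondR2⇒≤ᴸ C C' r2 i) y<t) ,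
  countBelow-mono C C' λ i → R2Pair⇒≤n {x = lookup C i} {lookup C' i} (r2 i)

CountR2-cong : (C C' D D' : Vec (Letter n) k) →
  (∀ t → countBelow t C' ≡ countBelow t D') → (∀ t → countBelow t C ≡ countBelow t D) →
  CountR2 C' C → CountR2 D' D
CountR2-cong {n} _ _ _ _ e′ e (below , atN) =
  (λ t → subst₂ _≤_ (e′ t) (e t) (below t)) , subst₂ _≤_ (e n) (e′ n) atN

CountR2-ord : (C C' : Vec (Letter n) k) → CountR2 C' C ⇔ CountR2 (ord C') (ord C)
CountR2-ord C C' = mk⇔
  (CountR2-cong C C' (ord C) (ord C') (λ t → sym (ord-countBelow t C')) (λ t → sym (ord-countBelow t C)))
  (CountR2-cong (ord C) (ord C') C C' (λ t → ord-countBelow t C') (λ t → ord-countBelow t C))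

sorted-CountR2⇒R2 : (C C' : Vec (Letter n) k) → Sorted C → Sorted C' → CountR2 C' C → CondR2 C' C
sorted-CountR2⇒R2 [] [] _ _ _ ()
sorted-CountR2⇒R2 {n} (x ∷ xs) (y ∷ ys) C↑@(_ ∷ xs↑) C'↑@(y≤ys ∷ ys↑) (below , atN) =
  CondR2-∷ (R2Pair-intro {x = x} {y = y} x≤y x<n⇒y<n)
           (sorted-CountR2⇒R2 xs ys xs↑ ys↑
              (below′ , countBelow-∷-cancel (x ∷ xs) (y ∷ ys) x≤y atN))
  where
  x≤y : x ≤ᴸ y
  x≤y = ≮⇒≥ λ y<x → <⇒≱
    (countBelow-strict (x ∷ xs) (y ∷ ys) (λ i z<x → contradiction z<x (≤⇒≯ (sorted-head-≤ C↑ i)))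
                       (zero , ≤-refl , y<x))
    (below (rank x))
  x<n⇒y<n : x ≤n → y ≤n
  x<n⇒y<n x<n = ≰⇒> λ n≤y → <⇒≱
    (countBelow-strict (y ∷ ys) (x ∷ xs)
                       (λ i z<n → contradiction z<n (≤⇒≯ (≤-trans n≤y (sorted-head-≤ C'↑ i))))
                       (zero , n≤y , x<n))
    atN
  below′ : ∀ t → countBelow t ys ≤ countBelow t xs
  below′ t with rank y <? t
  ... | yes y<t = m+o≤n+p⇒o≤p (𝟙-mono λ _ → y<t) (below t)
  ... | no y≮t  = countBelow-mono ys xs λ i z<t → contradiction (≤-<-trans (lookup⁺ y≤ys i) z<t) y≮t

CondC-CountR2⇒R2 : (C C' : Vec (Letter n) k) → CondC C' C → CountR2 C' C → CondR2 C' C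
CondC-CountR2⇒R2 [] [] _ _ ()
CondC-CountR2⇒R2 {n} (x ∷ xs) (y ∷ ys) cc (below , atN) =
  CondR2-∷ (R2Pair-intro {x = x} {y = y} x≤y (λ x<n → proj₂ (head-below n x<n atN)))
           (CondC-CountR2⇒R2 xs ys cc-tail (below′ , countBelow-∷-cancel (x ∷ xs) (y ∷ ys) x≤y atN))
  where
  cc-tail : CondC ys xs
  cc-tail i l i<l = cc (suc i) (suc l) (s<s i<l)
  cc-head : ∀ l → x ≤ᴸ lookup ys l → x ≤ᴸ y × y ≤ᴸ lookup ys l
  cc-head l x≤z = ¬≺≺⇒≤≤ x y (lookup ys l)
    (≤∧≢⇒< x≤z (proj₁ (cc zero (suc l) z<s) ∘ rank-injective)) (proj₂ (cc zero (suc l) z<s))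
  -- An entry of C' with rank in [x, b) exists; Condition C puts y between x and that entry.
  head-below : ∀ b → rank x < b → countBelow b (x ∷ xs) ≤ countBelow b (y ∷ ys) →
               x ≤ᴸ y × rank y < b
  head-below b x<b le with countBelow-<⇒∃ (y ∷ ys) (y ∷ ys) (begin-strict
      countBelow (rank x) (y ∷ ys)  ≤⟨ below (rank x) ⟩
      countBelow (rank x) (x ∷ xs)  <⟨ countBelow-strict (x ∷ xs) (x ∷ xs) (λ _ z<x → <-trans z<x x<b)
                                                         (zero , ≤-refl , x<b) ⟩
      countBelow b (x ∷ xs)         ≤⟨ le ⟩
      countBelow b (y ∷ ys)         ∎)
    where open ≤-Reasoning
  ... | zero  , y<b , x≤y = x≤y , y<b
  ... | suc l , z<b , x≤z = proj₁ (cc-head l x≤z) , ≤-<-trans (proj₂ (cc-head l x≤z)) z<b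
  x≤y : x ≤ᴸ y
  x≤y = proj₁ (head-below (n + n) (rank<2n x)
                 (countBelow-mono (x ∷ xs) (y ∷ ys) λ i _ → rank<2n (lookup (y ∷ ys) i)))
  below′ : ∀ t → countBelow t ys ≤ countBelow t xs
  below′ t with rank y <? t | rank x <? t
  ... | yes y<t | _       = m+o≤n+p⇒o≤p (𝟙-mono λ _ → y<t) (below t)
  ... | no _    | no x≮t = m+o≤n+p⇒o≤p (𝟙-mono λ x<t → contradiction x<t x≮t) (below t)
  ... | no y≮t  | yes x<t = begin
      countBelow t ys                               ≤⟨ countBelow-mono ys ys ys<t⇒ys<x ⟩
      countBelow (rank x) ys                        ≤⟨ m≤n+m _ _ ⟩
      countBelow (rank x) (y ∷ ys)                  ≤⟨ below (rank x) ⟩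
      𝟙[ rank x < rank x ] + countBelow (rank x) xs ≡⟨ cong (_+ countBelow (rank x) xs) (𝟙-no ≤-refl) ⟩
      countBelow (rank x) xs                        ≤⟨ countBelow-mono xs xs (λ _ z<x → <-trans z<x x<t) ⟩
      countBelow t xs                               ∎
    where
    open ≤-Reasoning
    ys<t⇒ys<x : ∀ l → rank (lookup ys l) < t → rank (lookup ys l) < rank x
    ys<t⇒ys<x l z<t = ≰⇒> λ x≤z → y≮t (≤-<-trans (proj₂ (cc-head l x≤z)) z<t)

_∉abs_ : Fin n → Vec (Letter n) k → Set
j ∉abs X = All (λ x → ∣ x ∣ᴸ ≢ j) X

avoids⇔∉abs : (a : Letter n) (X : Vec (Letter n) k) →
  (∀ i → (a ≢ lookup X i) × (a ≢ bar (lookup X i))) ⇔ ∣ a ∣ᴸ ∉abs X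
avoids⇔∉abs _ _ = mk⇔ (λ h → lookup⁻ (to ≢±⇔∣∣≢ ∘ h))
                      (λ h → from ≢±⇔∣∣≢ ∘ lookup⁺ h)

∉abs-transfer : {j : Fin n} (X Y : Vec (Letter n) k) →
  (∀ l → ∃[ i ] ∣ lookup Y l ∣ᴸ ≡ ∣ lookup X i ∣ᴸ) → j ∉abs X → j ∉abs Y
∉abs-transfer _ _ Y⊆X j∉X = lookup⁻ λ l → let (i , e) = Y⊆X l in lookup⁺ j∉X i ∘ trans (sym e)

absValues : Vec (Letter n) k → List (Fin n)
absValues []       = []
absValues (x ∷ xs) = ∣ x ∣ᴸ ∷ absValues xs

∈-absValues⁺ : (X : Vec (Letter n) k) (i : Fin k) → ∣ lookup X i ∣ᴸ ∈ absValues X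
∈-absValues⁺ (x ∷ xs) zero    = here refl
∈-absValues⁺ (x ∷ xs) (suc i) = there (∈-absValues⁺ xs i)

∈-absValues⁻ : {c : Fin n} (X : Vec (Letter n) k) → c ∈ absValues X → ∃[ i ] ∣ lookup X i ∣ᴸ ≡ c
∈-absValues⁻ (x ∷ xs) (here refl) = zero , refl
∈-absValues⁻ (x ∷ xs) (there c∈)  = let (i , e) = ∈-absValues⁻ xs c∈ in suc i , e

absValues-⊆ : (X Y : Vec (Letter n) k) →
  (∀ i → ∃[ j ] ∣ lookup X i ∣ᴸ ≡ ∣ lookup Y j ∣ᴸ) → absValues X ⊆ absValues Y
absValues-⊆ X Y X⊆Y c∈X with ∈-absValues⁻ X c∈X
... | i , refl = let (j , e) = X⊆Y i in subst (_∈ absValues Y) (sym e) (∈-absValues⁺ Y j)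

column⇒unique : (X : Vec (Letter n) k) → IsColumn X → Unique (absValues X)
column⇒unique []       _   = []
column⇒unique (x ∷ xs) col =
  ListAll.tabulate x∉xs ∷ column⇒unique xs λ i j e → Fin.suc-injective (col (suc i) (suc j) e)
  where
  x∉xs : ∀ {c} → c ∈ absValues xs → ∣ x ∣ᴸ ≢ c
  x∉xs c∈ e with ∈-absValues⁻ xs c∈
  ... | i , refl = Fin.0≢1+n (col zero (suc i) e)

countAbsAbove : Fin n → Vec (Letter n) k → ℕ
countAbsAbove j X = sum (map (λ a → 𝟙[ toℕ j < toℕ a ]) (absValues X))

countAbsAbove-R1 : (j : Fin n) (C C' : Vec (Letter n) k) → IsColumn C → IsColumn C' → CondR1 C' C →
                   countAbsAbove j C ≡ countAbsAbove j C'
countAbsAbove-R1 j C C' colC colC' (C⊆C' , C'⊆C) =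
  sum-map-≡ _ (column⇒unique C colC) (column⇒unique C' colC')
            (absValues-⊆ C C' C⊆C') (absValues-⊆ C' C C'⊆C)

𝟙-below-neg : (x : Letter n) (j : Fin n) → ∣ x ∣ᴸ ≢ j →
  𝟙[ rank x < rank (neg j) ] ≡ 𝟙[ rank x < rank (pos j) ] + 𝟙[ toℕ j < toℕ ∣ x ∣ᴸ ]
𝟙-below-neg (pos i) j i≢j with <-cmp (toℕ i) (toℕ j)
... | tri< i<j _ _ = trans (𝟙-yes (<-≤-trans (toℕ<n i) (n≤rank-neg j)))
                           (sym (cong₂ _+_ (𝟙-yes i<j) (𝟙-no (<⇒≤ i<j))))
... | tri≈ _ i≡j _ = contradiction (toℕ-injective i≡j) i≢j
... | tri> _ _ j<i = trans (𝟙-yes (<-≤-trans (toℕ<n i) (n≤rank-neg j)))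
                           (sym (cong₂ _+_ (𝟙-no (<⇒≤ j<i)) (𝟙-yes j<i)))
𝟙-below-neg (neg i) j _ = trans (𝟙-cong (rank-neg-<⇔ {i = i} {j}))
  (cong (_+ 𝟙[ toℕ j < toℕ i ]) (sym (𝟙-no (≤-trans (<⇒≤ (toℕ<n j)) (n≤rank-neg i)))))

countBelow-neg : (X : Vec (Letter n) k) (j : Fin n) → j ∉abs X →
  countBelow (rank (neg j)) X ≡ countBelow (rank (pos j)) X + countAbsAbove j X
countBelow-neg []       j []            = refl
countBelow-neg (x ∷ xs) j (x≢j ∷ j∉xs) =
  trans (cong₂ _+_ (𝟙-below-neg x j x≢j) (countBelow-neg xs j j∉xs))
        (interchange 𝟙[ rank x < toℕ j ] 𝟙[ toℕ j < toℕ ∣ x ∣ᴸ ]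
                     (countBelow (toℕ j) xs) (countAbsAbove j xs))

CountInInt : Vec (Letter n) k → Vec (Letter n) k → Letter n → Set
CountInInt C C' a = ∣ a ∣ᴸ ∉abs C × countBelow (rank a) C' < countBelow (rank a) C

InInt⇔CountInInt : (C C' : Vec (Letter n) k) {a : Letter n} → (∀ i → lookup C i ≤ᴸ lookup C' i) →
  (∀ {j} → j ∉abs C → j ∉abs C') → InInt C C' a ⇔ CountInInt C C' a
InInt⇔CountInInt C C' {a} C≤C' ∉C⇒∉C' = mk⇔ count uncount
  where
  count : InInt C C' a → CountInInt C C' a
  count ((i , c<a , a<c′) , avoids) = to (avoids⇔∉abs a C) avoids ,
    countBelow-strict C' C (λ i c′<a → ≤-<-trans (C≤C' i) c′<a) (i , <⇒≤ a<c′ , c<a)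
  uncount : CountInInt C C' a → InInt C C' a
  uncount (a∉C , lt) with countBelow-<⇒∃ C C' lt
  ... | i , c<a , a≤c′ = (i , c<a , ≤∧≢⇒< a≤c′ a≢c′) , from (avoids⇔∉abs a C) a∉C
    where
    a≢c′ : rank a ≢ rank (lookup C' i)
    a≢c′ e = lookup⁺ (∉C⇒∉C' a∉C) i (cong ∣_∣ᴸ (sym (rank-injective {x = a} {lookup C' i} e)))

CountInInt-bar : (C C' : Vec (Letter n) k) {j : Fin n} → IsColumn C → IsColumn C' → CondR1 C' C →
  CountInInt C C' (pos j) ⇔ CountInInt C C' (neg j)
CountInInt-bar C C' {j} colC colC' r1 =
  mk⇔ (λ (j∉C , lt) → j∉C , to (shift j∉C) lt) (λ (j∉C , lt) → j∉C , from (shift j∉C) lt)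
  where
  shift : j ∉abs C → (countBelow (rank (pos j)) C' < countBelow (rank (pos j)) C) ⇔
                     (countBelow (rank (neg j)) C' < countBelow (rank (neg j)) C)
  shift j∉C = mk⇔
    (λ lt → subst₂ _<_ (sym below-C') (sym below-C) (+-mono-<-≤ lt (≤-reflexive (sym same-above))))
    (λ lt → +-cancelʳ-< _ _ _ (subst₂ _<_ (trans below-C' (cong (_ +_) (sym same-above))) below-C lt))
    where
    below-C = countBelow-neg C j j∉C
    below-C' = countBelow-neg C' j (∉abs-transfer C C' (proj₂ r1) j∉C)
    same-above = countAbsAbove-R1 j C C' colC colC' r1

InInt-bar : (C C' : Vec (Letter n) k) → IsColumn C → IsColumn C' → CondR1 C' C → CondR2 C' C →
  ∀ a → InInt C C' a ⇔ InInt C C' (bar a)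
InInt-bar C C' colC colC' r1 r2 = λ { (pos j) → pos⇔neg ; (neg j) → ⇔.sym pos⇔neg }
  where
  characterise : ∀ {a} → InInt C C' a ⇔ CountInInt C C' a
  characterise = InInt⇔CountInInt C C' (CondR2⇒≤ᴸ C C' r2) (∉abs-transfer C C' (proj₂ r1))
  pos⇔neg : ∀ {j} → InInt C C' (pos j) ⇔ InInt C C' (neg j)
  pos⇔neg = ⇔.trans characterise (⇔.trans (CountInInt-bar C C' colC colC' r1) (⇔.sym characterise))

CountInInt-ord : (C C' : Vec (Letter n) k) {a : Letter n} →
  CountInInt C C' a ⇔ CountInInt (ord C) (ord C') a
CountInInt-ord C C' {a} = mk⇔
  (λ (a∉C , lt) → from All-ord a∉C ,
                  subst₂ _<_ (sym (ord-countBelow _ C')) (sym (ord-countBelow _ C)) lt)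
  (λ (a∉C , lt) → to All-ord a∉C , subst₂ _<_ (ord-countBelow _ C') (ord-countBelow _ C) lt)

CondR3-ord : (C C' : Vec (Letter n) k) → CondR1 C' C → CondR2 C' C → CondR2 (ord C') (ord C) →
  CondR3 C' C ⇔ CondR3 (ord C') (ord C)
CondR3-ord C C' r1 r2 r2′ =
  mk⇔ (λ r3 a → r3 a ∘ from (same a)) (λ r3 a → r3 a ∘ to (same a))
  where
  ∉C⇒∉C' : ∀ {j} → j ∉abs C → j ∉abs C'
  ∉C⇒∉C' = ∉abs-transfer C C' (proj₂ r1)
  same : ∀ a → InInt C C' a ⇔ InInt (ord C) (ord C') a
  same a = ⇔.trans (InInt⇔CountInInt C C' {a} (CondR2⇒≤ᴸ C C' r2) ∉C⇒∉C')
    (⇔.trans (CountInInt-ord C C' {a})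
      (⇔.sym (InInt⇔CountInInt (ord C) (ord C') {a} (CondR2⇒≤ᴸ (ord C) (ord C') r2′)
                                 (from All-ord ∘ ∉C⇒∉C' ∘ to All-ord))))

lemma8p5 : ∀ {n k : ℕ} (C C' : Vec (Letter n) k) →
    IsColumn C → IsColumn C' →
    CondC C' C → CondR1 C' C →
    (CondR2 C' C → ∀ (a : Letter n) → InInt C C' a ⇔ InInt C C' (bar a)) ×
    ((CondR2 C' C × CondR3 C' C) ⇔ (CondR2 (ord C') (ord C) × CondR3 (ord C') (ord C)))
lemma8p5 C C' colC colC' cc r1 = InInt-bar C C' colC colC' r1 , mk⇔ sort unsort
  where
  sort : CondR2 C' C × CondR3 C' C → CondR2 (ord C') (ord C) × CondR3 (ord C') (ord C)
  sort (r2 , r3) = r2′ , to (CondR3-ord C C' r1 r2 r2′) r3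
    where
    r2′ : CondR2 (ord C') (ord C)
    r2′ = sorted-CountR2⇒R2 (ord C) (ord C') (ord-sorted C) (ord-sorted C')
                            (to (CountR2-ord C C') (R2⇒CountR2 C C' r2))
  unsort : CondR2 (ord C') (ord C) × CondR3 (ord C') (ord C) → CondR2 C' C × CondR3 C' C
  unsort (r2′ , r3′) = r2 , from (CondR3-ord C C' r1 r2 r2′) r3′
    where
    r2 : CondR2 C' C
    r2 = CondC-CountR2⇒R2 C C' cc (from (CountR2-ord C C') (R2⇒CountR2 (ord C) (ord C') r2′))
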